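{- Let $p\ge1$ and $n\ge 3p+1$. With $\mathcal{C}_0,\mathcal{C}_1,\dots$ defined below for $\Delta_2^t(C_n^p)$ using the vertex order $x_j=j$: if $\sigma\in\mathcal{C}_1$, then $\sigma^c\subseteq\{0,m_\sigma-p,m_\sigma-p+1,\dots,m_\sigma\}$ and $\sigma\in\mathcal{C}_{m_\sigma-p}$.
   Context: For a graph $G$, $\Delta_2^t(G)$ is the simplicial complex whose faces are the $\sigma\subseteq V(G)$ such that $\sigma^c:=V(G)\setminus\sigma$ contains two distinct non-adjacent vertices. $C_n^p$ has vertex set $\{0,\dots,n-1\}$ with distinct $u,v$ adjacent iff $v\equiv u\pm t\pmod n$ for some $1\le t\le p$. For $\sigma\in\Delta_2^t(C_n^p)$, $m_\sigma:=\max(\sigma^c)$ (one has $p+1\le m_\sigma\le n-1$). Given vertices $x_0,\dots,x_{n-1}$, set $\mathcal{C}_0=\Delta_2^t(G)$ and for $0\le j\le n-1$ put $\mathcal{M}_{x_j}=\{\{\sigma\setminus\{x_j\},\sigma\cup\{x_j\}\}\mid \sigma\setminus\{x_j\},\sigma\cup\{x_j\}\in\mathcal{C}_j\}$ and $\mathcal{C}_{j+1}=\{\sigma\in\mathcal{C}_j\mid \sigma\text{ lies in no pair of }\mathcal{M}_{x_j}\}$. Here $G=C_n^p$ and $x_j=j$. -}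

module Defs where

open import Data.Nat using (ℕ; zero; suc; _+_; _*_; _∸_; _≤_; _<_; _<?_)
open import Data.Fin using (Fin; toℕ; fromℕ<)
open import Data.Fin.Subset using (Subset; _∈_; _∉_; _∪_; _-_; ⁅_⁆)
open import Data.Product using (Σ; ∃; ∃-syntax; _×_)
open import Data.Sum using (_⊎_)
open import Relation.Binary.PropositionalEquality using (_≡_; _≢_)
open import Relation.Nullary using (¬_; yes; no)

_≡_[mod_] : ℕ → ℕ → ℕ → Set
a ≡ b [mod n ] = ∃[ k ] ∃[ l ] (a + k * n ≡ b + l * n)

-- adjacency in C_n^p on vertex set {0,…,n-1}:
-- distinct u,v with v ≡ u ± t (mod n) for some 1 ≤ t ≤ p
-- (v ≡ u - t  is written as  u ≡ v + t)
Adj : (n p : ℕ) → Fin n → Fin n → Set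
Adj n p u v = u ≢ v × ∃[ t ] (1 ≤ t × t ≤ p ×
  ((toℕ v ≡ toℕ u + t [mod n ]) ⊎ (toℕ u ≡ toℕ v + t [mod n ])))

-- faces of Δ₂ᵗ(C_n^p): σᶜ contains two distinct non-adjacent vertices
Face : (n p : ℕ) → Subset n → Set
Face n p σ = ∃[ u ] ∃[ v ] (u ∉ σ × v ∉ σ × u ≢ v × ¬ Adj n p u v)

-- the complexes 𝒞_j for the vertex order x_j = j (j < n).
-- 𝒞_{j+1} = {σ ∈ 𝒞_j | σ lies in no pair {τ∖{x_j}, τ∪{x_j}} with both in 𝒞_j},
-- i.e. σ ∈ 𝒞_j and not (σ∖{x_j} ∈ 𝒞_j and σ∪{x_j} ∈ 𝒞_j).
-- Only indices j ≤ n are meaningful; beyond that the sequence is kept constant.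
𝒞 : (n p : ℕ) → ℕ → Subset n → Set
𝒞 n p zero σ = Face n p σ
𝒞 n p (suc j) σ with j <? n
... | yes j<n = 𝒞 n p j σ × ¬ (𝒞 n p j (σ - x) × 𝒞 n p j (σ ∪ ⁅ x ⁆))
  where x = fromℕ< j<n
... | no _ = 𝒞 n p j σ

IsMaxCompl : {n : ℕ} → Subset n → Fin n → Set
IsMaxCompl σ m = m ∉ σ × (∀ u → u ∉ σ → toℕ u ≤ toℕ m)

-- Membership σ ∈ 𝒞₁ says that σ is a face while σ ∪ {0} is not, i.e. any two
-- distinct vertices of σᶜ other than 0 are adjacent.  A non-adjacent pair in σᶜ
-- therefore contains 0, which yields w ∈ σᶜ with p < w < n − p, and maximality
-- of m gives m ≤ w + p.  As n ≥ 3p + 1, every nonzero u with u + p < m lies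
-- more than p away (cyclically) from w or from m, so u ∈ σ.  The same pair
-- {u, w} or {u, m} shows that (σ ∖ {u}) ∪ {0} is a face, so σ ∖ {u} ∉ 𝒞₁ ⊇ 𝒞ᵤ:
-- σ is never matched at the steps 1 ≤ j < m − p.
module Submission where

open import Defs
open import Data.Nat using (ℕ; zero; suc; _+_; _*_; _∸_; _≤_; _<_; _≤?_; _<?_; NonZero; z≤n; s≤s)
open import Data.Nat.Properties
open import Data.Nat.DivMod using (_%_; [m+kn]%n≡m%n; [m+n]%n≡m%n; m<n⇒m%n≡m)
open import Data.Nat.Tactic.RingSolver using (solve-∀)
open import Data.Fin using (Fin; zero; suc; toℕ; fromℕ<)
open import Data.Fin.Properties using (toℕ<n; toℕ-fromℕ<) renaming (<⇒≢ to toℕ<⇒≢)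
open import Data.Fin.Subset using (Subset; _∉_; _⊆_; _∪_; _-_; ⁅_⁆)
open import Data.Fin.Subset.Properties using (x∈p∪q⁻; x≢y⇒x∉⁅y⁆; p─q⊆p)
open import Data.Vec.Base using (_∷_; there)
open import Data.Product using (_×_; _,_; proj₁; ∃-syntax)
open import Data.Sum using (_⊎_; inj₁; inj₂; [_,_])
open import Data.Empty using (⊥; ⊥-elim)
open import Function using (id; _∘_)
open import Relation.Nullary using (¬_; yes; no)
open import Relation.Binary.PropositionalEquality using (_≡_; _≢_; refl; sym; trans; cong; subst; module ≡-Reasoning)

x∉p-x : ∀ {n} (p : Subset n) (x : Fin n) → x ∉ p - x
x∉p-x (_ ∷ p) zero    ()
x∉p-x (_ ∷ p) (suc x) (there x∈p-x) = x∉p-x p x x∈p-x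

x∉p⇒x∉p-y : ∀ {n} {x : Fin n} (p : Subset n) (y : Fin n) → x ∉ p → x ∉ p - y
x∉p⇒x∉p-y p y x∉p = x∉p ∘ p─q⊆p p ⁅ y ⁆

x∉p∧x∉q⇒x∉p∪q : ∀ {n} {x : Fin n} (p q : Subset n) → x ∉ p → x ∉ q → x ∉ p ∪ q
x∉p∧x∉q⇒x∉p∪q p q x∉p x∉q = [ x∉p , x∉q ] ∘ x∈p∪q⁻ p q

Face-antitone : ∀ {n p} {σ τ : Subset n} → τ ⊆ σ → Face n p σ → Face n p τ
Face-antitone τ⊆σ (u , v , u∉σ , v∉σ , u≢v , ¬adj) = u , v , u∉σ ∘ τ⊆σ , v∉σ ∘ τ⊆σ , u≢v , ¬adj

Adj-sym : ∀ {n p} {u v : Fin n} → Adj n p u v → Adj n p v u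
Adj-sym (u≢v , t , 1≤t , t≤p , inj₁ eq) = u≢v ∘ sym , t , 1≤t , t≤p , inj₂ eq
Adj-sym (u≢v , t , 1≤t , t≤p , inj₂ eq) = u≢v ∘ sym , t , 1≤t , t≤p , inj₁ eq

≡[mod]⇒≡% : ∀ {a b n} .{{_ : NonZero n}} → a < n → a ≡ b [mod n ] → a ≡ b % n
≡[mod]⇒≡% {a} {b} {n} a<n (k , l , eq) = begin
  a                ≡⟨ sym (m<n⇒m%n≡m a<n) ⟩
  a % n            ≡⟨ sym ([m+kn]%n≡m%n a k n) ⟩
  (a + k * n) % n  ≡⟨ cong (_% n) eq ⟩
  (b + l * n) % n  ≡⟨ [m+kn]%n≡m%n b l n ⟩
  b % n            ∎
  where open ≡-Reasoning

≡[mod]⇒≡⊎+n≡ : ∀ {a b n} .{{_ : NonZero n}} → a < n → b < n + n →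
               a ≡ b [mod n ] → a ≡ b ⊎ a + n ≡ b
≡[mod]⇒≡⊎+n≡ {a} {b} {n} a<n b<2n a≡b with b <? n
... | yes b<n = inj₁ (trans (≡[mod]⇒≡% a<n a≡b) (m<n⇒m%n≡m b<n))
... | no b≮n = inj₂ (begin
  a + n      ≡⟨ cong (_+ n) a≡b∸n ⟩
  b ∸ n + n  ≡⟨ m∸n+n≡m n≤b ⟩
  b          ∎)
  where
  open ≡-Reasoning
  n≤b : n ≤ b
  n≤b = ≮⇒≥ b≮n
  a≡b∸n : a ≡ b ∸ n
  a≡b∸n = begin
    a                ≡⟨ ≡[mod]⇒≡% a<n a≡b ⟩
    b % n            ≡⟨ cong (_% n) (sym (m∸n+n≡m n≤b)) ⟩
    (b ∸ n + n) % n  ≡⟨ [m+n]%n≡m%n (b ∸ n) n ⟩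
    (b ∸ n) % n      ≡⟨ m<n⇒m%n≡m (m<n+o⇒m∸n<o b n b<2n) ⟩
    b ∸ n            ∎

FarApart : (n p : ℕ) → Fin n → Fin n → Set
FarApart n p u v = toℕ u + p < toℕ v × toℕ v + p < toℕ u + n

FarApart⇒¬Adj : ∀ {n p} {u v : Fin n} → FarApart n p u v → ¬ Adj n p u v
FarApart⇒¬Adj {n@(suc _)} {p} {u} {v} (u+p<v , v+p<u+n) (_ , t , _ , t≤p , v≡u+t∨u≡v+t) =
  [ [ v≢u+t , v+n≢u+t ] ∘ ≡[mod]⇒≡⊎+n≡ (toℕ<n v) (+t<n+n u)
  , [ u≢v+t , u+n≢v+t ] ∘ ≡[mod]⇒≡⊎+n≡ (toℕ<n u) (+t<n+n v)
  ] v≡u+t∨u≡v+t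
  where
  a = toℕ u
  b = toℕ v
  +t<n+n : ∀ (x : Fin n) → toℕ x + t < n + n
  +t<n+n x = +-mono-< (toℕ<n x) (≤-<-trans t≤p (≤-<-trans (m≤n+m p a) (<-trans u+p<v (toℕ<n v))))
  v≢u+t : b ≢ a + t
  v≢u+t b≡a+t = <⇒≱ u+p<v (≤-trans (≤-reflexive b≡a+t) (+-monoʳ-≤ a t≤p))
  v+n≢u+t : b + n ≢ a + t
  v+n≢u+t b+n≡a+t = <⇒≱ (<-≤-trans u+p<v (m≤m+n b n)) (≤-trans (≤-reflexive b+n≡a+t) (+-monoʳ-≤ a t≤p))
  u≢v+t : a ≢ b + t
  u≢v+t a≡b+t = <⇒≱ (≤-<-trans (m≤m+n a p) u+p<v) (≤-trans (m≤m+n b t) (≤-reflexive (sym a≡b+t)))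
  u+n≢v+t : a + n ≢ b + t
  u+n≢v+t a+n≡b+t = <⇒≱ v+p<u+n (≤-trans (≤-reflexive a+n≡b+t) (+-monoʳ-≤ b t≤p))

¬Adj-zero⇒central : ∀ {N p} {v : Fin N} → ¬ Adj (suc N) p zero (suc v) →
                    p < toℕ (suc v) × toℕ (suc v) + p < suc N
¬Adj-zero⇒central {N} {p} {v} ¬adj with toℕ (suc v) ≤? p | suc N ≤? toℕ (suc v) + p
... | yes v≤p | _ = ⊥-elim (¬adj ((λ ()) , toℕ (suc v) , s≤s z≤n , v≤p , inj₁ (0 , 0 , refl)))
... | no _ | yes n≤v+p = ⊥-elim (¬adj ((λ ()) , suc N ∸ toℕ (suc v) , m<n⇒0<n∸m (toℕ<n (suc v))
                           , m≤n+o⇒m∸n≤o (suc N) (toℕ (suc v)) n≤v+p , inj₂ (1 , 0 , wraps)))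
  where
  wraps : suc N + 0 ≡ toℕ (suc v) + (suc N ∸ toℕ (suc v)) + 0
  wraps = cong (_+ 0) (sym (m+[n∸m]≡n (<⇒≤ (toℕ<n (suc v)))))
... | no v≰p | no n≰v+p = ≰⇒> v≰p , ≰⇒> n≰v+p

𝒞-suc⇒𝒞 : ∀ {n p} j {σ} → 𝒞 n p (suc j) σ → 𝒞 n p j σ
𝒞-suc⇒𝒞 {n} j σ∈𝒞 with j <? n
... | yes _ = proj₁ σ∈𝒞
... | no _  = σ∈𝒞

𝒞-suc⇒𝒞₁ : ∀ {n p} j {σ} → 𝒞 n p (suc j) σ → 𝒞 n p 1 σ
𝒞-suc⇒𝒞₁             zero    = id
𝒞-suc⇒𝒞₁ {n} {p} (suc j) = 𝒞-suc⇒𝒞₁ {n} {p} j ∘ 𝒞-suc⇒𝒞 {n} {p} (suc j)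

𝒞-suc⁺ : ∀ {n p} j {σ} → 𝒞 n p j σ → (∀ x → toℕ x ≡ j → ¬ 𝒞 n p j (σ - x)) → 𝒞 n p (suc j) σ
𝒞-suc⁺ {n} j σ∈𝒞 σ-x∉𝒞 with j <? n
... | yes j<n = σ∈𝒞 , σ-x∉𝒞 (fromℕ< j<n) (toℕ-fromℕ< j<n) ∘ proj₁
... | no _    = σ∈𝒞

𝒞₁⇒𝒞 : ∀ {n p σ} k → 𝒞 n p 1 σ →
       (∀ x → 1 ≤ toℕ x → toℕ x < k → ¬ 𝒞 n p 1 (σ - x)) → 𝒞 n p k σ
𝒞₁⇒𝒞                     zero          σ∈𝒞₁ _      = 𝒞-suc⇒𝒞 0 σ∈𝒞₁
𝒞₁⇒𝒞                     (suc zero)    σ∈𝒞₁ _      = σ∈𝒞₁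
𝒞₁⇒𝒞 {n} {p}     (suc (suc j)) σ∈𝒞₁ σ-x∉𝒞₁ = 𝒞-suc⁺ (suc j)
  (𝒞₁⇒𝒞 (suc j) σ∈𝒞₁ λ x 1≤x x<k → σ-x∉𝒞₁ x 1≤x (m<n⇒m<1+n x<k))
  λ x x≡1+j → σ-x∉𝒞₁ x (subst (1 ≤_) (sym x≡1+j) (s≤s z≤n)) (s≤s (≤-reflexive x≡1+j)) ∘ 𝒞-suc⇒𝒞₁ {n} {p} j

𝒞₁⇒¬Face∪zero : ∀ {N p σ} → 𝒞 (suc N) p 1 σ → ¬ Face (suc N) p (σ ∪ ⁅ zero ⁆)
𝒞₁⇒¬Face∪zero (σ-face , ¬both) = ¬both ∘ (Face-antitone (p─q⊆p _ _) σ-face ,_)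

𝒞₁⇒Adj : ∀ {N p σ} {u v : Fin (suc N)} → 𝒞 (suc N) p 1 σ → u ∉ σ → v ∉ σ →
         u ≢ zero → v ≢ zero → u ≢ v → ¬ ¬ Adj (suc N) p u v
𝒞₁⇒Adj {σ = σ} σ∈𝒞₁ u∉σ v∉σ u≢0 v≢0 u≢v ¬adj = 𝒞₁⇒¬Face∪zero σ∈𝒞₁
  (_ , _ , x∉p∧x∉q⇒x∉p∪q σ _ u∉σ (x≢y⇒x∉⁅y⁆ u≢0) , x∉p∧x∉q⇒x∉p∪q σ _ v∉σ (x≢y⇒x∉⁅y⁆ v≢0) , u≢v , ¬adj)

𝒞₁⇒¬FarApart : ∀ {N p σ} {u v : Fin (suc N)} → 𝒞 (suc N) p 1 σ → u ∉ σ → v ∉ σ →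
               u ≢ zero → v ≢ zero → ¬ FarApart (suc N) p u v
𝒞₁⇒¬FarApart {u = u} σ∈𝒞₁ u∉σ v∉σ u≢0 v≢0 far@(u+p<v , _) =
  𝒞₁⇒Adj σ∈𝒞₁ u∉σ v∉σ u≢0 v≢0 (toℕ<⇒≢ (≤-<-trans (m≤m+n (toℕ u) _) u+p<v)) (FarApart⇒¬Adj far)

𝒞₁⇒central-outside : ∀ {N p σ} → 𝒞 (suc N) p 1 σ →
                     ∃[ w ] (w ∉ σ × p < toℕ w × toℕ w + p < suc N)
𝒞₁⇒central-outside σ∈𝒞₁ with proj₁ σ∈𝒞₁
... | zero  , zero  , _   , _   , 0≢0 , _    = ⊥-elim (0≢0 refl)
... | zero  , suc v , _   , v∉σ , _   , ¬adj = suc v , v∉σ , ¬Adj-zero⇒central ¬adj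
... | suc u , zero  , u∉σ , _   , _   , ¬adj = suc u , u∉σ , ¬Adj-zero⇒central (¬adj ∘ Adj-sym)
... | suc u , suc v , u∉σ , v∉σ , u≢v , ¬adj = ⊥-elim (𝒞₁⇒Adj σ∈𝒞₁ u∉σ v∉σ (λ ()) (λ ()) u≢v ¬adj)

module _ {N p : ℕ} (3p+1≤n : 3 * p + 1 ≤ suc N) {σ : Subset (suc N)} (σ∈𝒞₁ : 𝒞 (suc N) p 1 σ)
         {m : Fin (suc N)} (m∉σ : m ∉ σ) (m-max : ∀ u → u ∉ σ → toℕ u ≤ toℕ m)
         {w : Fin (suc N)} (w∉σ : w ∉ σ) (p<w : p < toℕ w) (w+p<n : toℕ w + p < suc N) where

  private
    w≢zero : w ≢ zero
    w≢zero refl = n≮0 p<w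

    p<m : p < toℕ m
    p<m = <-≤-trans p<w (m-max w w∉σ)

    m≢zero : m ≢ zero
    m≢zero refl = n≮0 p<m

    <∸p⇒+p< : ∀ {u} → u < toℕ m ∸ p → u + p < toℕ m
    <∸p⇒+p< {u} = m≤o∸n⇒m+n≤o (suc u) (<⇒≤ p<m)

    m≤w+p : toℕ m ≤ toℕ w + p
    m≤w+p with toℕ m ≤? toℕ w + p
    ... | yes m≤w+p = m≤w+p
    ... | no m≰w+p  = ⊥-elim (𝒞₁⇒¬FarApart σ∈𝒞₁ w∉σ m∉σ w≢zero m≢zero (≰⇒> m≰w+p , m+p<w+n))
      where
      m+p<w+n : toℕ m + p < toℕ w + suc N
      m+p<w+n = subst (toℕ m + p <_) (+-comm (suc N) (toℕ w)) (+-mono-< (toℕ<n m) p<w)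

    FarApart-w⊎FarApart-m : ∀ u → toℕ u + p < toℕ m → FarApart (suc N) p u w ⊎ FarApart (suc N) p u m
    FarApart-w⊎FarApart-m u u+p<m with toℕ m + p <? toℕ u + suc N
    ... | yes m+p<u+n = inj₂ (u+p<m , m+p<u+n)
    ... | no m+p≮u+n  = inj₁ (u+p<w , <-≤-trans w+p<n (m≤n+m (suc N) (toℕ u)))
      where
      open ≤-Reasoning
      regroup : ∀ a b → suc (a + b) + (b + b) ≡ a + (3 * b + 1)
      regroup = solve-∀
      u+p<w : toℕ u + p < toℕ w
      u+p<w = +-cancelʳ-≤ (p + p) (suc (toℕ u + p)) (toℕ w) (begin
        suc (toℕ u + p) + (p + p)  ≡⟨ regroup (toℕ u) p ⟩
        toℕ u + (3 * p + 1)        ≤⟨ +-monoʳ-≤ (toℕ u) 3p+1≤n ⟩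
        toℕ u + suc N              ≤⟨ ≮⇒≥ m+p≮u+n ⟩
        toℕ m + p                  ≤⟨ +-monoˡ-≤ p m≤w+p ⟩
        toℕ w + p + p              ≡⟨ +-assoc (toℕ w) p p ⟩
        toℕ w + (p + p)            ∎)

    𝒞₁-outside-near-m : ∀ {τ u} → 𝒞 (suc N) p 1 τ → w ∉ τ → m ∉ τ → u ∉ τ → u ≢ zero →
                        toℕ u + p < toℕ m → ⊥
    𝒞₁-outside-near-m {u = u} τ∈𝒞₁ w∉τ m∉τ u∉τ u≢0 u+p<m =
      [ 𝒞₁⇒¬FarApart τ∈𝒞₁ u∉τ w∉τ u≢0 w≢zero , 𝒞₁⇒¬FarApart τ∈𝒞₁ u∉τ m∉τ u≢0 m≢zero ]
        (FarApart-w⊎FarApart-m u u+p<m)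

  complement-near-max : ∀ u → u ∉ σ → toℕ u ≡ 0 ⊎ (toℕ m ∸ p ≤ toℕ u × toℕ u ≤ toℕ m)
  complement-near-max zero      _   = inj₁ refl
  complement-near-max u@(suc _) u∉σ with toℕ m ∸ p ≤? toℕ u
  ... | yes m∸p≤u = inj₂ (m∸p≤u , m-max u u∉σ)
  ... | no m∸p≰u  = ⊥-elim (𝒞₁-outside-near-m σ∈𝒞₁ w∉σ m∉σ u∉σ (λ ()) (<∸p⇒+p< (≰⇒> m∸p≰u)))

  survives-until-max∸p : 𝒞 (suc N) p (toℕ m ∸ p) σ
  survives-until-max∸p = 𝒞₁⇒𝒞 (toℕ m ∸ p) σ∈𝒞₁ λ x 1≤x x<m∸p σ-x∈𝒞₁ →
    𝒞₁-outside-near-m σ-x∈𝒞₁ (x∉p⇒x∉p-y σ x w∉σ) (x∉p⇒x∉p-y σ x m∉σ) (x∉p-x σ x)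
      (λ { refl → n≮0 1≤x }) (<∸p⇒+p< x<m∸p)

proposition3p6 : (p n : ℕ) → 1 ≤ p → 3 * p + 1 ≤ n →
    (σ : Subset n) → 𝒞 n p 1 σ → (m : Fin n) → IsMaxCompl σ m →
      (∀ u → u ∉ σ → toℕ u ≡ 0 ⊎ (toℕ m ∸ p ≤ toℕ u × toℕ u ≤ toℕ m))
      × 𝒞 n p (toℕ m ∸ p) σ
proposition3p6 p (suc N) _ 3p+1≤n σ σ∈𝒞₁ m (m∉σ , m-max)
  with w , w∉σ , p<w , w+p<n ← 𝒞₁⇒central-outside σ∈𝒞₁ =
    complement-near-max   3p+1≤n σ∈𝒞₁ m∉σ m-max w∉σ p<w w+p<n
  , survives-until-max∸p 3p+1≤n σ∈𝒞₁ m∉σ m-max w∉σ p<w w+p<n
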